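{- Let $\Delta\geq2$ and $k$ be integers with $1\leq k\leq \Delta-1$, and let $m\leq k(\Delta-k+3)-1$. Then there is no deterministic one-round distributed algorithm that, on every graph $G$ of maximum degree $\Delta$ given with a proper input $m$-coloring, computes a proper coloring of $G$ with $q=m-k$ colors.
   Context: Setting (LOCAL model, unbounded message size): each vertex initially knows only its own color in a proper input coloring with colors $\{0,\ldots,m-1\}$ and the parameters $m,\Delta$; there are no unique identifiers. In one communication round each vertex learns the input colors of its neighbors, so a one-round algorithm is a function mapping a vertex's own input color together with the set of its neighbors' input colors to an output color in $\{0,\ldots,q-1\}$. Proper means adjacent vertices receive different colors. -}

module Defs where

open import Data.Nat using (ℕ)
open import Data.Bool using (Bool; true; false; _∧_; if_then_else_)
open import Data.Fin using (Fin; _≟_)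
open import Data.Fin.Subset using (Subset; ∣_∣)
open import Data.Vec using (tabulate)
open import Data.List using (allFin)
open import Data.Bool.ListAction using (any)
open import Data.Product using (Σ; _×_)
open import Relation.Binary.PropositionalEquality using (_≡_; _≢_)
open import Relation.Nullary.Decidable using (⌊_⌋)

record Graph (n : ℕ) : Set where
  field
    adj   : Fin n → Fin n → Bool
    sym   : ∀ u v → adj u v ≡ adj v u
    irrefl : ∀ u → adj u u ≡ false
open Graph public

degree : ∀ {n} → Graph n → Fin n → ℕ
degree G u = ∣ tabulate (adj G u) ∣

MaxDegree : ∀ {n} → Graph n → ℕ → Set
MaxDegree {n} G Δ = (∀ u → degree G u Data.Nat.≤ Δ) × Σ (Fin n) (λ u → degree G u ≡ Δ)

Proper : ∀ {n c} → Graph n → (Fin n → Fin c) → Set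
Proper G col = ∀ u v → adj G u v ≡ true → col u ≢ col v

-- a deterministic one-round algorithm (no IDs): own input colour and the
-- set of neighbours' input colours ↦ output colour in Fin q
OneRound : ℕ → ℕ → Set
OneRound m q = Fin m → Subset m → Fin q

nbrColours : ∀ {n m} → Graph n → (Fin n → Fin m) → Fin n → Subset m
nbrColours {n} G col u =
  tabulate (λ c → any (λ v → adj G u v ∧ ⌊ col v ≟ c ⌋) (allFin n))

run : ∀ {n m q} → OneRound m q → Graph n → (Fin n → Fin m) → Fin n → Fin q
run A G col u = A (col u) (nbrColours G col u)

-- Call x a possible output for (c, d) if A outputs x at some vertex of colour c, of degree Δ,
-- one of whose neighbours has colour d. No x is possible for both (c, d) and (d, c): joining
-- the two views by an edge between their centres gives a double star of maximum degree Δ on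
-- which A gives two adjacent vertices the colour x. Call x universal for c if it is possible
-- for (c, d) for every d ≠ c; distinct colours have distinct universal outputs, so at least
-- m − q = k colours K₀, …, K_{k−1} are blocked, i.e. have no universal output. For a blocked
-- Kᵢ start from the view whose neighbours carry the other k − 1 colours Kⱼ and repeatedly add a
-- neighbour colour for which the current output is impossible: this yields Δ − k + 2 distinct
-- outputs, each possible for (Kᵢ, Kⱼ) for all j ≠ i. Outputs for different Kᵢ are distinct by
-- the first observation, so k (Δ − k + 2) ≤ q = m − k, contradicting m < k (Δ − k + 3).
module Submission where

open import Defs
open import Data.Bool using (Bool; true; false; T; not; _xor_)
open import Data.Bool.Properties using (T-≡; T-∧; xor-comm; xor-same)
open import Data.Bool.ListAction using (any)
open import Data.Empty using (⊥)
open import Data.Fin using (Fin; zero; suc; _↑ˡ_; _↑ʳ_; splitAt; punchIn; punchOut; fromℕ<)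
open import Data.Fin.Permutation.Components using (transpose; transpose-inverse)
open import Data.Fin.Properties
  using (suc-injective; 0≢1+n; ¬Fin0; splitAt-↑ˡ; splitAt-↑ʳ; punchInᵢ≢i; punchIn-punchOut;
         punchOut-injective; injective⇒≤; *↔×; all?; any?; ¬∀⟶∃¬)
  renaming (_≟_ to _≟ᶠ_)
open import Data.Fin.Subset using (Subset; _∈_; _⊆_; ∣_∣) renaming (⊥ to ∅)
open import Data.Fin.Subset.Properties using (⊆-antisym)
open import Data.List using (List; []; _∷_; length; lookup; allFin)
import Data.List as List
open import Data.List.Membership.Propositional using () renaming (_∈_ to _∈ₗ_)
open import Data.List.Membership.Propositional.Properties using (∈-lookup; ∈-tabulate⁺)
open import Data.List.Properties using (length-tabulate)
open import Data.List.Relation.Unary.All as All using (All; []; _∷_)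
open import Data.List.Relation.Unary.All.Properties using (tabulate⁺)
open import Data.List.Relation.Unary.Any using (here; there; index)
open import Data.List.Relation.Unary.Any.Properties using (any⇔; tabulate⁻; lookup-index)
import Data.List.Relation.Unary.Any.Properties as Any
open import Data.Nat using (ℕ; zero; suc; _+_; _*_; _∸_; _≤_; _<_; s≤s; z≤n)
open import Data.Nat.Properties
  using (≤-trans; ≤-reflexive; ≤-pred; +-suc; +-comm; *-suc; +-monoʳ-≤; +-∸-assoc; m+[n∸m]≡n;
         m∸n+n≡m; m≤m+n; m+n≤o⇒n≤o; m≤n⇒m∸n≡0; <-irrefl; <-≤-trans; <⇒≤; ≰⇒>; n≤1+n; _≤?_;
         module ≤-Reasoning)
open import Data.Product using (Σ; Σ-syntax; ∃-syntax; _×_; _,_; proj₁; proj₂; map₂)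
import Data.Product as Product
open import Data.Sum using (_⊎_; inj₁; inj₂; [_,_]′; map₁)
open import Data.Vec using (tabulate)
open import Data.Vec.Functional using () renaming (_∷_ to _∷ᵥ_)
open import Data.Vec.Properties using (lookup∘tabulate; []=⇒lookup; lookup⇒[]=)
open import Function using (_∘_; _⇔_; mk⇔; Equivalence; Injective; Injection; _↣_)
open import Function.Properties.Inverse using (↔⇒↣)
open import Relation.Binary.PropositionalEquality as ≡ using (_≡_; _≢_; refl; trans; cong; cong₂; subst)
open import Relation.Nullary using (¬_; Dec; yes; no; contradiction)
open import Relation.Nullary.Decidable
  using (⌊_⌋; toWitness; fromWitness; ¬?; _×-dec_; decidable-stable; ¬¬-excluded-middle)
open import Relation.Unary using (Decidable)

open Equivalence using (to; from)

private variable
  m n n′ q : ℕ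

∈-tabulate : {p : Fin n → Bool} {i : Fin n} → i ∈ tabulate p ⇔ T (p i)
∈-tabulate {p = p} {i} = mk⇔
  (λ i∈ → from T-≡ (trans (≡.sym (lookup∘tabulate p i)) ([]=⇒lookup i∈)))
  (λ pi → lookup⇒[]= i (tabulate p) (trans (lookup∘tabulate p i) (to T-≡ pi)))

∈-tabulate-any : {p : Fin m → Fin n → Bool} {i : Fin m} →
                 i ∈ tabulate (λ i → any (p i) (allFin n)) ⇔ (∃[ j ] T (p i j))
∈-tabulate-any = mk⇔ (tabulate⁻ ∘ from any⇔ ∘ to ∈-tabulate)
                     (λ (j , pj) → from ∈-tabulate (to any⇔ (Any.tabulate⁺ j pj)))

colourSet : (Fin n → Fin m) → Subset m
colourSet {n} f = tabulate (λ i → any (λ j → ⌊ f j ≟ᶠ i ⌋) (allFin n))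

∈-colourSet : {f : Fin n → Fin m} {i : Fin m} → i ∈ colourSet f ⇔ (∃[ j ] f j ≡ i)
∈-colourSet = mk⇔ (map₂ toWitness ∘ to ∈-tabulate-any) (from ∈-tabulate-any ∘ map₂ fromWitness)

∈-nbrColours : {G : Graph n} {col : Fin n → Fin m} {u : Fin n} {i : Fin m} →
               i ∈ nbrColours G col u ⇔ (∃[ v ] adj G u v ≡ true × col v ≡ i)
∈-nbrColours = mk⇔
  (map₂ (Product.map (to T-≡) toWitness ∘ to T-∧) ∘ to ∈-tabulate-any)
  (from ∈-tabulate-any ∘ map₂ (from T-∧ ∘ Product.map (from T-≡) fromWitness))

colourSet-⊆ : {f : Fin n → Fin m} {g : Fin n′ → Fin m} → (∀ j → ∃[ k ] g k ≡ f j) →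
              colourSet f ⊆ colourSet g
colourSet-⊆ f⊆g i∈ = let j , fj≡i = to ∈-colourSet i∈
                         k , gk≡fj = f⊆g j
                     in from ∈-colourSet (k , trans gk≡fj fj≡i)

colourSet-∘-surjective : {f : Fin n → Fin m} (σ : Fin n′ → Fin n) → (∀ j → ∃[ k ] σ k ≡ j) →
                         colourSet (f ∘ σ) ≡ colourSet f
colourSet-∘-surjective {f = f} σ σ-onto = ⊆-antisym
  (colourSet-⊆ (λ k → σ k , refl))
  (colourSet-⊆ (λ j → let k , σk≡j = σ-onto j in k , cong f σk≡j))

∣tabulate-false∣ : ∣ tabulate {n = n} (λ _ → false) ∣ ≡ 0
∣tabulate-false∣ {zero}  = refl
∣tabulate-false∣ {suc n} = ∣tabulate-false∣ {n}

∣tabulate-true∣ : ∣ tabulate {n = n} (λ _ → true) ∣ ≡ n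
∣tabulate-true∣ {zero}  = refl
∣tabulate-true∣ {suc n} = cong suc (∣tabulate-true∣ {n})

∣tabulate∘splitAt∣ : ∀ m {n} (h : Fin m ⊎ Fin n → Bool) →
                     ∣ tabulate (h ∘ splitAt m) ∣ ≡ ∣ tabulate (h ∘ inj₁) ∣ + ∣ tabulate (h ∘ inj₂) ∣
∣tabulate∘splitAt∣ zero    h = refl
∣tabulate∘splitAt∣ (suc m) h with h (inj₁ zero)
... | true  = cong suc (∣tabulate∘splitAt∣ m (h ∘ map₁ suc))
... | false = ∣tabulate∘splitAt∣ m (h ∘ map₁ suc)

pad : {A : Set} → A → List A → Fin n → A
pad d []       _       = d
pad d (x ∷ xs) zero    = x
pad d (x ∷ xs) (suc j) = pad d xs j

pad-All : {A : Set} {P : A → Set} {d : A} {D : List A} → P d → All P D → (j : Fin n) → P (pad d D j)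
pad-All pd []        _       = pd
pad-All pd (px ∷ _)  zero    = px
pad-All pd (_ ∷ pxs) (suc j) = pad-All pd pxs j

∈-pad : {A : Set} {d x : A} {D : List A} → x ∈ₗ D → length D ≤ n → Σ[ j ∈ Fin n ] pad d D j ≡ x
∈-pad {n = suc n} (here refl) _ = zero , refl
∈-pad {n = suc n} {d = d} (there x∈) (s≤s len) = let j , e = ∈-pad {d = d} x∈ len in suc j , e

∈⇒lookup : {A : Set} {x : A} {D : List A} → x ∈ₗ D → ∃[ k ] lookup D k ≡ x
∈⇒lookup x∈ = index x∈ , ≡.sym (lookup-index x∈)

listSet : List (Fin m) → Subset m
listSet D = colourSet (lookup D)

colourSet-pad : {d : Fin m} {D : List (Fin m)} → d ∈ₗ D → length D ≤ n →
                colourSet (pad {n} d D) ≡ listSet D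
colourSet-pad {n = n} {d = d} {D = D} d∈ len = ⊆-antisym
  (colourSet-⊆ {f = pad {n} d D} {g = lookup D} (pad-All {d = d} {D = D} (∈⇒lookup d∈) (All.tabulate ∈⇒lookup)))
  (colourSet-⊆ {f = lookup D} {g = pad {n} d D} (λ k → ∈-pad {n = n} {d = d} {D = D} (∈-lookup k) len))

cons-injective : {A : Set} {x : A} {f : Fin n → A} → Injective _≡_ _≡_ f → (∀ j → f j ≢ x) →
                 Injective _≡_ _≡_ (x ∷ᵥ f)
cons-injective f-inj f≢x {zero}  {zero}  _ = refl
cons-injective f-inj f≢x {zero}  {suc j} e = contradiction (≡.sym e) (f≢x j)
cons-injective f-inj f≢x {suc i} {zero}  e = contradiction e (f≢x i)
cons-injective f-inj f≢x {suc i} {suc j} e = cong suc (f-inj e)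

satisfying-injection : ∀ {m q} k {P : Fin m → Set} → Decidable P →
                       (g : ∀ i → ¬ P i → Fin q) → (∀ {i j} ¬pi ¬pj → g i ¬pi ≡ g j ¬pj → i ≡ j) →
                       q + k ≤ m → Σ[ h ∈ (Fin k → Fin m) ] Injective _≡_ _≡_ h × (∀ a → P (h a))
satisfying-injection zero _ _ _ _ = (λ ()) , (λ { {()} }) , (λ ())
satisfying-injection {zero} {q} (suc k) _ _ _ q+k≤0 with () ← m+n≤o⇒n≤o q q+k≤0
satisfying-injection {suc m} {q} (suc k) {P} P? g g-inj q+k≤m with P? zero
... | yes p₀ =
  let h , h-inj , Ph = satisfying-injection k (P? ∘ suc) (g ∘ suc) (λ ¬pi ¬pj → suc-injective ∘ g-inj ¬pi ¬pj)
                         (≤-pred (subst (_≤ suc m) (+-suc q k) q+k≤m))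
  in zero ∷ᵥ (suc ∘ h) , cons-injective (h-inj ∘ suc-injective) (λ _ ()) , λ { zero → p₀ ; (suc a) → Ph a }
... | no ¬p₀ = skip g g-inj q+k≤m
  where
  skip : ∀ {q} (g : ∀ i → ¬ P i → Fin q) → (∀ {i j} ¬pi ¬pj → g i ¬pi ≡ g j ¬pj → i ≡ j) →
         q + suc k ≤ suc m → Σ[ h ∈ (Fin (suc k) → Fin (suc m)) ] Injective _≡_ _≡_ h × (∀ a → P (h a))
  skip {zero}  g _     _     = contradiction (g zero ¬p₀) ¬Fin0
  skip {suc q} g g-inj q+k≤m =
    let h , h-inj , Ph = satisfying-injection (suc k) (P? ∘ suc) g′
                           (λ ¬pi ¬pj → suc-injective ∘ g-inj ¬pi ¬pj ∘ punchOut-injective (g₀≢ ¬pi) (g₀≢ ¬pj))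
                           (≤-pred q+k≤m)
    in suc ∘ h , h-inj ∘ suc-injective , Ph
    where
    g₀≢ : ∀ {i} (¬pi : ¬ P (suc i)) → g zero ¬p₀ ≢ g (suc i) ¬pi
    g₀≢ ¬pi = 0≢1+n ∘ g-inj ¬p₀ ¬pi
    g′ : ∀ i → ¬ P (suc i) → Fin q
    g′ i ¬pi = punchOut (g₀≢ ¬pi)

¬¬-∀-Fin : {P : Fin n → Set} → (∀ i → ¬ ¬ P i) → ¬ ¬ (∀ i → P i)
¬¬-∀-Fin {zero}  _   ¬all = ¬all (λ ())
¬¬-∀-Fin {suc n} ¬¬p ¬all = ¬¬p zero λ p₀ → ¬¬-∀-Fin (¬¬p ∘ suc) λ ps → ¬all λ { zero → p₀ ; (suc i) → ps i }

-- Two stars with Δ′ leaves each, centres (false , zero) and (true , zero), whose centres are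
-- joined. Position zero of nbrs s is the colour of the other centre.
module DoubleStar {m Δ′ : ℕ} (centre : Bool → Fin m) (nbrs : Bool → Fin (suc Δ′) → Fin m)
                  (nbrs-partner : ∀ s → nbrs s zero ≡ centre (not s))
                  (nbrs-proper : ∀ s j → nbrs s j ≢ centre s) where

  Vertex : Set
  Vertex = Bool × Fin (suc Δ′)

  edge : Vertex → Vertex → Bool
  edge (s , zero)  (t , zero)  = s xor t
  edge (s , zero)  (t , suc _) = not (s xor t)
  edge (s , suc _) (t , zero)  = not (s xor t)
  edge (s , suc _) (t , suc _) = false

  colour : Vertex → Fin m
  colour (s , zero)  = centre s
  colour (s , suc j) = nbrs s (suc j)

  edge-sym : ∀ p r → edge p r ≡ edge r p
  edge-sym (s , zero)  (t , zero)  = xor-comm s t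
  edge-sym (s , zero)  (t , suc _) = cong not (xor-comm s t)
  edge-sym (s , suc _) (t , zero)  = cong not (xor-comm s t)
  edge-sym (s , suc _) (t , suc _) = refl

  edge-irrefl : ∀ p → edge p p ≡ false
  edge-irrefl (s , zero)  = xor-same s
  edge-irrefl (s , suc _) = refl

  edge-centre : ∀ s r → edge (s , zero) r ≡ true → ∃[ j ] nbrs s j ≡ colour r
  edge-centre false (true  , zero)  _ = zero , nbrs-partner false
  edge-centre true  (false , zero)  _ = zero , nbrs-partner true
  edge-centre false (false , suc j) _ = suc j , refl
  edge-centre true  (true  , suc j) _ = suc j , refl
  edge-centre false (false , zero)  ()
  edge-centre true  (true  , zero)  ()
  edge-centre false (true  , suc j) ()
  edge-centre true  (false , suc j) ()

  centre-edge : ∀ s j → ∃[ r ] edge (s , zero) r ≡ true × colour r ≡ nbrs s j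
  centre-edge false zero    = (true  , zero)  , refl , ≡.sym (nbrs-partner false)
  centre-edge true  zero    = (false , zero)  , refl , ≡.sym (nbrs-partner true)
  centre-edge false (suc j) = (false , suc j) , refl , refl
  centre-edge true  (suc j) = (true  , suc j) , refl , refl

  edge-proper : ∀ p r → edge p r ≡ true → colour p ≢ colour r
  edge-proper (s , zero) r e c≡ =
    let j , nj≡ = edge-centre s r e in nbrs-proper s j (trans nj≡ (≡.sym c≡))
  edge-proper (s , suc j) (t , zero) e c≡ =
    let j′ , nj≡ = edge-centre t (s , suc j) (trans (edge-sym (t , zero) (s , suc j)) e)
    in nbrs-proper t j′ (trans nj≡ c≡)
  edge-proper (s , suc _) (t , suc _) ()

  rowDegree : Vertex → ℕ
  rowDegree p = ∣ tabulate (edge p ∘ (false ,_)) ∣ + ∣ tabulate (edge p ∘ (true ,_)) ∣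

  rowDegree-centre : ∀ s → rowDegree (s , zero) ≡ suc Δ′
  rowDegree-centre false rewrite ∣tabulate-false∣ {Δ′} | ∣tabulate-true∣ {Δ′} = +-comm Δ′ 1
  rowDegree-centre true  rewrite ∣tabulate-false∣ {Δ′} | ∣tabulate-true∣ {Δ′} = refl

  rowDegree-≤ : ∀ p → rowDegree p ≤ suc Δ′
  rowDegree-≤ (s     , zero)  = ≤-reflexive (rowDegree-centre s)
  rowDegree-≤ (false , suc _) rewrite ∣tabulate-false∣ {Δ′} = s≤s z≤n
  rowDegree-≤ (true  , suc _) rewrite ∣tabulate-false∣ {Δ′} = s≤s z≤n

  vertex : Fin (suc Δ′ + suc Δ′) → Vertex
  vertex v = [ (false ,_) , (true ,_) ]′ (splitAt (suc Δ′) v)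

  position : Vertex → Fin (suc Δ′ + suc Δ′)
  position (false , a) = a ↑ˡ suc Δ′
  position (true  , a) = suc Δ′ ↑ʳ a

  vertex-position : ∀ p → vertex (position p) ≡ p
  vertex-position (false , a) = cong [ (false ,_) , (true ,_) ]′ (splitAt-↑ˡ (suc Δ′) a (suc Δ′))
  vertex-position (true  , a) = cong [ (false ,_) , (true ,_) ]′ (splitAt-↑ʳ (suc Δ′) (suc Δ′) a)

  graph : Graph (suc Δ′ + suc Δ′)
  graph = record
    { adj    = λ u v → edge (vertex u) (vertex v)
    ; sym    = λ u v → edge-sym (vertex u) (vertex v)
    ; irrefl = λ u → edge-irrefl (vertex u)
    }

  colouring : Fin (suc Δ′ + suc Δ′) → Fin m
  colouring = colour ∘ vertex

  colouring-proper : Proper graph colouring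
  colouring-proper u v = edge-proper (vertex u) (vertex v)

  degree-vertex : ∀ u → degree graph u ≡ rowDegree (vertex u)
  degree-vertex u = ∣tabulate∘splitAt∣ (suc Δ′) (edge (vertex u) ∘ [ (false ,_) , (true ,_) ]′)

  graph-maxDegree : MaxDegree graph (suc Δ′)
  graph-maxDegree = (λ u → subst (_≤ suc Δ′) (≡.sym (degree-vertex u)) (rowDegree-≤ (vertex u)))
                  , zero , trans (degree-vertex zero) (rowDegree-centre false)

  centres-adjacent : adj graph (position (false , zero)) (position (true , zero)) ≡ true
  centres-adjacent = cong₂ edge (vertex-position (false , zero)) (vertex-position (true , zero))

  nbrColours-centre : ∀ s → nbrColours graph colouring (position (s , zero)) ≡ colourSet (nbrs s)
  nbrColours-centre s = ⊆-antisym
    (from ∈-colourSet ∘ nbr⇒ ∘ to (∈-nbrColours {G = graph} {u = position (s , zero)}))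
    (from (∈-nbrColours {G = graph} {u = position (s , zero)}) ∘ ⇒nbr ∘ to ∈-colourSet)
    where
    adj-centre : ∀ v → adj graph (position (s , zero)) v ≡ edge (s , zero) (vertex v)
    adj-centre v = cong (λ p → edge p (vertex v)) (vertex-position (s , zero))

    nbr⇒ : ∀ {i} → ∃[ v ] adj graph (position (s , zero)) v ≡ true × colouring v ≡ i → ∃[ j ] nbrs s j ≡ i
    nbr⇒ (v , e , c≡) =
      map₂ (λ n≡ → trans n≡ c≡) (edge-centre s (vertex v) (trans (≡.sym (adj-centre v)) e))

    ⇒nbr : ∀ {i} → ∃[ j ] nbrs s j ≡ i → ∃[ v ] adj graph (position (s , zero)) v ≡ true × colouring v ≡ i
    ⇒nbr (j , n≡) = let r , e , c≡ = centre-edge s j in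
      position r , trans (adj-centre (position r)) (trans (cong (edge (s , zero)) (vertex-position r)) e)
               , trans (cong colour (vertex-position r)) (trans c≡ n≡)

  run-centre : (A : OneRound m q) → ∀ s →
               run A graph colouring (position (s , zero)) ≡ A (centre s) (colourSet (nbrs s))
  run-centre A s = cong₂ A (cong colour (vertex-position (s , zero))) (nbrColours-centre s)

Solves : OneRound m q → ℕ → Set
Solves {m} A Δ = ∀ (n : ℕ) (G : Graph n) → MaxDegree G Δ →
                 (col : Fin n → Fin m) → Proper G col → Proper G (run A G col)

module _ {m q Δ′ : ℕ} (A : OneRound m q) where

  -- f lists the colours of the Δ = suc Δ′ neighbours of a vertex of colour c.
  CanOutput : Fin m → Fin m → Fin q → Set
  CanOutput c d x = Σ[ f ∈ (Fin (suc Δ′) → Fin m) ]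
                      (∀ j → f j ≢ c) × (∃[ j ] f j ≡ d) × A c (colourSet f) ≡ x

  canOutput-conflict : Solves A (suc Δ′) → ∀ {c d x} → CanOutput c d x → CanOutput d c x → ⊥
  canOutput-conflict solves {c} {d} {x} (f , f≢c , (j , fj≡d) , Af≡x) (g , g≢d , (k , gk≡c) , Ag≡x) =
    solves _ graph graph-maxDegree colouring colouring-proper
           (position (false , zero)) (position (true , zero))
           centres-adjacent (trans (centre-output false) (≡.sym (centre-output true)))
    where
    transpose-onto : ∀ {n} (i : Fin (suc n)) j → ∃[ l ] transpose zero i l ≡ j
    transpose-onto i j = transpose i zero j , transpose-inverse zero i

    centre : Bool → Fin m
    centre false = c
    centre true  = d

    nbrs : Bool → Fin (suc Δ′) → Fin m
    nbrs false = f ∘ transpose zero j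
    nbrs true  = g ∘ transpose zero k

    nbrs-partner : ∀ s → nbrs s zero ≡ centre (not s)
    nbrs-partner false = fj≡d
    nbrs-partner true  = gk≡c

    nbrs-proper : ∀ s i → nbrs s i ≢ centre s
    nbrs-proper false i = f≢c (transpose zero j i)
    nbrs-proper true  i = g≢d (transpose zero k i)

    open DoubleStar centre nbrs nbrs-partner nbrs-proper

    centre-output : ∀ s → run A graph colouring (position (s , zero)) ≡ x
    centre-output false =
      trans (run-centre A false) (trans (cong (A c) (colourSet-∘-surjective _ (transpose-onto j))) Af≡x)
    centre-output true  =
      trans (run-centre A true) (trans (cong (A d) (colourSet-∘-surjective _ (transpose-onto k))) Ag≡x)

  canOutput-listSet : ∀ {c d} {D : List (Fin m)} → d ∈ₗ D → All (_≢ c) D → length D ≤ suc Δ′ →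
                      CanOutput c d (A c (listSet D))
  canOutput-listSet {c} {d} {D} d∈ D≢c len =
    pad d D , pad-All (All.lookup D≢c d∈) D≢c , ∈-pad d∈ len , cong (A c) (colourSet-pad d∈ len)

  module Blocking (conflict : ∀ {c d x} → CanOutput c d x → CanOutput d c x → ⊥)
                  (decide : ∀ c d x → Dec (CanOutput c d x)) where

    Blocked : Fin m → Set
    Blocked c = ∀ x → ∃[ b ] b ≢ c × ¬ CanOutput c b x

    blocker? : ∀ c x → Dec (∃[ b ] b ≢ c × ¬ CanOutput c b x)
    blocker? c x = any? λ b → ¬? (b ≟ᶠ c) ×-dec ¬? (decide c b x)

    universalOutput : ∀ c → ¬ Blocked c → ∃[ x ] ∀ d → d ≢ c → CanOutput c d x
    universalOutput c ¬blocked =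
      let x , ¬blocker = ¬∀⟶∃¬ q _ (blocker? c) ¬blocked
      in x , λ d d≢c → decidable-stable (decide c d x) (λ ¬out → ¬blocker (d , d≢c , ¬out))

    universalOutput-injective : ∀ {c c′} ¬bc ¬bc′ →
                                proj₁ (universalOutput c ¬bc) ≡ proj₁ (universalOutput c′ ¬bc′) → c ≡ c′
    universalOutput-injective {c} {c′} ¬bc ¬bc′ e with c ≟ᶠ c′
    ... | yes c≡c′ = c≡c′
    ... | no  c≢c′ = contradiction
      (proj₂ (universalOutput c ¬bc) c′ (c≢c′ ∘ ≡.sym))
      (λ out → conflict out (subst (CanOutput c′ c) (≡.sym e) (proj₂ (universalOutput c′ ¬bc′) c c≢c′)))

    blocked-chain : ∀ {c} → Blocked c → (D : List (Fin m)) → All (_≢ c) D → ∀ ℓ → length D + ℓ ≤ suc Δ′ →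
                    Σ[ x ∈ (Fin (suc ℓ) → Fin q) ]
                      Injective _≡_ _≡_ x × (∀ j {d} → d ∈ₗ D → CanOutput c d (x j))
    blocked-chain {c} blocked D D≢c zero len =
      (λ _ → A c (listSet D)) , (λ { {zero} {zero} _ → refl })
      , λ _ d∈ → canOutput-listSet d∈ D≢c (≤-trans (m≤m+n _ 0) len)
    blocked-chain {c} blocked D D≢c (suc ℓ) len =
      let x₀ = A c (listSet D)
          b , b≢c , ¬out = blocked x₀
          xs , xs-inj , xs-out = blocked-chain blocked (b ∷ D) (b≢c ∷ D≢c) ℓ
                                   (subst (_≤ suc Δ′) (+-suc (length D) ℓ) len)
      in x₀ ∷ᵥ xs
       , cons-injective xs-inj (λ j e → ¬out (subst (CanOutput c b) e (xs-out j (here refl))))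
       , λ { zero    d∈ → canOutput-listSet d∈ D≢c (≤-trans (m≤m+n _ (suc ℓ)) len)
           ; (suc j) d∈ → xs-out j (there d∈) }

    blocked-family-bound : ∀ {k} (K : Fin (suc k) → Fin m) → Injective _≡_ _≡_ K → (∀ a → Blocked (K a)) →
                           k ≤ suc Δ′ → suc k * suc (suc Δ′ ∸ k) ≤ q
    blocked-family-bound {k} K K-inj K-blocked k≤Δ =
      injective⇒≤ {f = F ∘ Injection.to pairing} (Injection.injective pairing ∘ F-injective)
      where
      ℓ : ℕ
      ℓ = suc Δ′ ∸ k

      pairing : Fin (suc k * suc ℓ) ↣ (Fin (suc k) × Fin (suc ℓ))
      pairing = ↔⇒↣ *↔×

      others : Fin (suc k) → List (Fin m)
      others a = List.tabulate (K ∘ punchIn a)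

      others-∈ : ∀ {a a′} → a ≢ a′ → K a′ ∈ₗ others a
      others-∈ {a} a≢a′ = subst (λ z → K z ∈ₗ others a) (punchIn-punchOut a≢a′) (∈-tabulate⁺ (punchOut a≢a′))

      chain : ∀ a → Σ[ x ∈ (Fin (suc ℓ) → Fin q) ]
                      Injective _≡_ _≡_ x × (∀ j {d} → d ∈ₗ others a → CanOutput (K a) d (x j))
      chain a = blocked-chain (K-blocked a) (others a) (tabulate⁺ (λ t → punchInᵢ≢i a t ∘ K-inj)) ℓ
                  (≤-reflexive (trans (cong (_+ ℓ) (length-tabulate _)) (m+[n∸m]≡n k≤Δ)))

      F : Fin (suc k) × Fin (suc ℓ) → Fin q
      F (a , j) = proj₁ (chain a) j

      F-injective : Injective _≡_ _≡_ F
      F-injective {a , j} {a′ , j′} e with a ≟ᶠ a′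
      ... | yes refl = cong (a ,_) (proj₁ (proj₂ (chain a)) e)
      ... | no a≢a′  = contradiction
        (proj₂ (proj₂ (chain a)) j (others-∈ a≢a′))
        (λ out → conflict out (subst (CanOutput (K a′) (K a)) (≡.sym e)
                                     (proj₂ (proj₂ (chain a′)) j′ (others-∈ (a≢a′ ∘ ≡.sym)))))

    outputs-bound : ∀ k → q + suc k ≤ m → k ≤ suc Δ′ → suc k * suc (suc Δ′ ∸ k) ≤ q
    outputs-bound k q+k≤m k≤Δ =
      let K , K-inj , K-blocked = satisfying-injection (suc k) (λ c → all? (blocker? c))
                                    (λ c → proj₁ ∘ universalOutput c) universalOutput-injective q+k≤m
      in blocked-family-bound K K-inj K-blocked k≤Δ

*-bound-arith : ∀ {K m} t → K * (2 + t) ≤ m ∸ K → K ≤ m → K * (t + 3) ≤ m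
*-bound-arith {K} {m} t bound K≤m = begin
  K * (t + 3)      ≡⟨ cong (K *_) (+-comm t 3) ⟩
  K * suc (2 + t)  ≡⟨ *-suc K (2 + t) ⟩
  K + K * (2 + t)  ≤⟨ +-monoʳ-≤ K bound ⟩
  K + (m ∸ K)      ≡⟨ m+[n∸m]≡n K≤m ⟩
  m                ∎
  where open ≤-Reasoning

lemma11 : (Δ k m : ℕ) → 2 ≤ Δ → 1 ≤ k → k ≤ Δ ∸ 1 → m < k * (Δ ∸ k + 3) → 1 ≤ m →
          ¬ (Σ (OneRound m (m ∸ k)) (λ A →
               ∀ (n : ℕ) (G : Graph n) → MaxDegree G Δ →
               (col : Fin n → Fin m) → Proper G col → Proper G (run A G col)))
lemma11 (suc Δ′) (suc k) m _ _ k<Δ m<bound 1≤m (A , solves) with suc k ≤? m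
... | no  k≰m = ¬Fin0 (subst Fin (m≤n⇒m∸n≡0 (<⇒≤ (≰⇒> k≰m))) (A (fromℕ< 1≤m) ∅))
... | yes k<m =
  -- the goal is ⊥, so every CanOutput c d x may be decided classically
  ¬¬-∀-Fin (λ c → ¬¬-∀-Fin λ d → ¬¬-∀-Fin λ x → ¬¬-excluded-middle) λ decide →
  let open Blocking A (canOutput-conflict A solves) decide
      bound = outputs-bound k (≤-reflexive (m∸n+n≡m k<m)) (≤-trans k≤Δ′ (n≤1+n Δ′))
  in <-irrefl refl (<-≤-trans m<bound
       (*-bound-arith (Δ′ ∸ k) (subst (λ L → suc k * suc L ≤ m ∸ suc k) (+-∸-assoc 1 k≤Δ′) bound) k<m))
  where
  k≤Δ′ : k ≤ Δ′
  k≤Δ′ = ≤-trans (n≤1+n k) k<Δ
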